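{- For every $n$, there exists a multigraph on $n$ nodes and $O(n^2)$ edges for which every friendly minimum $s,t$-cut sparsifier has $\Omega(n^2)$ edges.
   Context: Graphs are undirected and may have parallel edges; $\deg(v)$ counts parallel edges and $E(A,B)$ is the multiset of edges between $A$ and $B$. A cut $S\subseteq V$ is \emph{unfriendly} if there is a node $s\in S$ with $|E(\{s\},V\setminus S)|>0.6\deg(s)$ or a node $t\notin S$ with $|E(\{t\},S)|>0.6\deg(t)$; otherwise it is \emph{friendly}. A \emph{sparsifier} $H$ of $G$ is obtained by deleting edges and contracting subsets of nodes (removing self-loops; parallel edges kept and counted separately); $H$ \emph{preserves} a cut of $G$ if none of its edges is deleted and no two nodes from different sides are contracted together. $H$ is a \emph{friendly minimum $s,t$-cut sparsifier} of $G$ if for every pair $s,t$ for which all the minimum $s,t$-cuts in $G$ are friendly, at least one minimum $s,t$-cut of $G$ is preserved in $H$. -}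

module Defs where

open import Data.Nat using (ℕ; zero; suc; _+_; _*_; _≤_; _<ᵇ_)
open import Data.Fin using (Fin; toℕ) renaming (zero to fzero; suc to fsuc)
open import Data.Fin.Properties using (_≟_)
open import Data.Bool using (Bool; true; false; if_then_else_; _∧_; not; _xor_)
open import Data.Product using (Σ; _×_; ∃)
open import Relation.Nullary using (¬_; does)
open import Relation.Binary.PropositionalEquality using (_≡_; _≢_)

sumFin : (n : ℕ) → (Fin n → ℕ) → ℕ
sumFin zero    f = 0
sumFin (suc n) f = f fzero + sumFin n (λ i → f (fsuc i))

record MultiGraph (n : ℕ) : Set where
  field
    mult     : Fin n → Fin n → ℕ
    symm     : ∀ u v → mult u v ≡ mult v u
    loopless : ∀ u → mult u u ≡ 0
open MultiGraph public

-- Number of edges of a (symmetric) multiplicity function: each unordered pair once.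
edgeCount : (n : ℕ) → (Fin n → Fin n → ℕ) → ℕ
edgeCount n w = sumFin n λ u → sumFin n λ v → if toℕ u <ᵇ toℕ v then w u v else 0

numEdges : ∀ {n} → MultiGraph n → ℕ
numEdges {n} G = edgeCount n (mult G)

deg : ∀ {n} → MultiGraph n → Fin n → ℕ
deg {n} G v = sumFin n λ u → mult G v u

-- A cut S ⊆ V, given by its indicator (true = in S).
Cut : ℕ → Set
Cut n = Fin n → Bool

crossDeg : ∀ {n} → MultiGraph n → Cut n → Fin n → ℕ
crossDeg {n} G S v = sumFin n λ u → if S u xor S v then mult G v u else 0

cutValue : ∀ {n} → MultiGraph n → Cut n → ℕ
cutValue {n} G S = sumFin n λ u → sumFin n λ v →
  if S u ∧ not (S v) then mult G u v else 0

-- Friendly: no node has more than 0.6 of its degree crossing the cut,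
-- i.e. for every v, 10 * |E({v}, other side)| ≤ 6 * deg(v).
Friendly : ∀ {n} → MultiGraph n → Cut n → Set
Friendly G S = ∀ v → 10 * crossDeg G S v ≤ 6 * deg G v

IsMinCut : ∀ {n} → MultiGraph n → Fin n → Fin n → Cut n → Set
IsMinCut G s t S =
  S s ≡ true × S t ≡ false ×
  (∀ S' → S' s ≡ true → S' t ≡ false → cutValue G S ≤ cutValue G S')

-- A sparsifier: delete edges (keep ≤ mult, symmetric) and then contract the
-- fibres of a surjection π : Fin n → Fin m (self-loops removed, parallel edges kept).
record Sparsifier {n : ℕ} (G : MultiGraph n) : Set where
  field
    m        : ℕ
    keep     : Fin n → Fin n → ℕ
    keepSymm : ∀ u v → keep u v ≡ keep v u
    keep≤    : ∀ u v → keep u v ≤ mult G u v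
    π        : Fin n → Fin m
    πSurj    : ∀ a → ∃ λ u → π u ≡ a
open Sparsifier public

sparsMult : ∀ {n} {G : MultiGraph n} → (H : Sparsifier G) → Fin (m H) → Fin (m H) → ℕ
sparsMult {n} H a b =
  if does (a ≟ b) then 0 else
    (sumFin n λ u → sumFin n λ v →
      if does (π H u ≟ a) ∧ does (π H v ≟ b) then keep H u v else 0)

sparsEdges : ∀ {n} {G : MultiGraph n} → Sparsifier G → ℕ
sparsEdges H = edgeCount (m H) (sparsMult H)

Preserves : ∀ {n} {G : MultiGraph n} → Sparsifier G → Cut n → Set
Preserves {G = G} H S =
  (∀ u v → S u ≡ true → S v ≡ false → keep H u v ≡ mult G u v) ×
  (∀ u v → S u ≡ true → S v ≡ false → π H u ≢ π H v)

IsFriendlyMinCutSparsifier : ∀ {n} (G : MultiGraph n) → Sparsifier G → Set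
IsFriendlyMinCutSparsifier {n} G H =
  ∀ (s t : Fin n) → s ≢ t →
  (∀ S → IsMinCut G s t S → Friendly G S) →
  ∃ λ S → IsMinCut G s t S × Preserves H S

-- Join every node v to its mirror image opposite v by 4n parallel edges and every other pair
-- by a single edge, leaving the middle node isolated when n is odd; this graph has 5n² edges.
-- Let q = ⌊n/4⌋, take s among the first q nodes and t among the next q. The cut {s, opposite s}
-- has value at most 2n, so every minimum s,t-cut has value at most 2n, whereas every
-- non-isolated node has degree at least 4n: all minimum s,t-cuts are friendly. A preserved
-- minimum s,t-cut keeps the single edge st and does not contract s with t, so every friendly
-- minimum s,t-cut sparsifier retains all q² such edges, and each edge of it is counted at most
-- twice among them.
module Submission where

open import Defs
open import Data.Nat using (ℕ; _*_; _≤_)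
open import Data.Product using (Σ; _×_; ∃)
open import Data.Nat using (zero; suc; _+_; _<_; _<ᵇ_; z≤n; s≤s)
open import Data.Nat.Properties hiding (_≟_)
open import Data.Nat.DivMod using (_/_; _%_; m≡m%n+[m/n]*n; m%n<n; m/n*n≤m; /-monoˡ-≤)
open import Data.Nat.Tactic.RingSolver using (solve-∀)
open import Data.Fin using (Fin; toℕ; opposite) renaming (zero to fzero; suc to fsuc)
open import Data.Fin.Properties using (_≟_; opposite-prop; opposite-involutive; toℕ-injective; toℕ<n)
open import Data.Bool using (Bool; true; false; if_then_else_; _∧_; _∨_; not; _xor_; T)
open import Data.Bool.Properties using (∨-comm)
open import Data.Product using (_,_)
open import Data.Sum using (_⊎_; inj₁; inj₂)
open import Data.Empty using (⊥-elim)
open import Data.Unit using (tt)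
open import Function using (_∘_; mk⇔)
open import Relation.Nullary using (¬_; Dec; does; yes; no)
open import Relation.Nullary.Decidable using (does-⇔; dec-true; dec-false)
open import Relation.Binary.PropositionalEquality
open import Algebra.Properties.CommutativeSemigroup +-commutativeSemigroup using (interchange)

sumFin-cong : ∀ n {f g : Fin n → ℕ} → (∀ i → f i ≡ g i) → sumFin n f ≡ sumFin n g
sumFin-cong zero    f≗g = refl
sumFin-cong (suc n) f≗g = cong₂ _+_ (f≗g fzero) (sumFin-cong n (f≗g ∘ fsuc))

sumFin-mono : ∀ n {f g : Fin n → ℕ} → (∀ i → f i ≤ g i) → sumFin n f ≤ sumFin n g
sumFin-mono zero    f≤g = z≤n
sumFin-mono (suc n) f≤g = +-mono-≤ (f≤g fzero) (sumFin-mono n (f≤g ∘ fsuc))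

sumFin-distrib-+ : ∀ n (f g : Fin n → ℕ) →
                   sumFin n (λ i → f i + g i) ≡ sumFin n f + sumFin n g
sumFin-distrib-+ zero    f g = refl
sumFin-distrib-+ (suc n) f g =
  trans (cong (f fzero + g fzero +_) (sumFin-distrib-+ n (f ∘ fsuc) (g ∘ fsuc)))
        (interchange (f fzero) (g fzero) _ _)

sumFin-const : ∀ n c → sumFin n (λ _ → c) ≡ n * c
sumFin-const zero    c = refl
sumFin-const (suc n) c = cong (c +_) (sumFin-const n c)

sumFin-zero : ∀ n → sumFin n (λ _ → 0) ≡ 0
sumFin-zero n = trans (sumFin-const n 0) (*-zeroʳ n)

sumFin-distribˡ-* : ∀ n c (f : Fin n → ℕ) → sumFin n (λ i → c * f i) ≡ c * sumFin n f
sumFin-distribˡ-* zero    c f = sym (*-zeroʳ c)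
sumFin-distribˡ-* (suc n) c f =
  trans (cong (c * f fzero +_) (sumFin-distribˡ-* n c (f ∘ fsuc)))
        (sym (*-distribˡ-+ c (f fzero) _))

sumFin-if : ∀ n b (f : Fin n → ℕ) →
            sumFin n (λ i → if b then f i else 0) ≡ (if b then sumFin n f else 0)
sumFin-if n true  f = refl
sumFin-if n false f = sumFin-zero n

sumFin-comm : ∀ m n (f : Fin m → Fin n → ℕ) →
              sumFin m (λ i → sumFin n (f i)) ≡ sumFin n (λ j → sumFin m (λ i → f i j))
sumFin-comm zero    n f = sym (sumFin-zero n)
sumFin-comm (suc m) n f =
  trans (cong (sumFin n (f fzero) +_) (sumFin-comm m n (f ∘ fsuc)))
        (sym (sumFin-distrib-+ n (f fzero) _))

term≤sumFin : ∀ n (f : Fin n → ℕ) i → f i ≤ sumFin n f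
term≤sumFin (suc n) f fzero    = m≤m+n _ _
term≤sumFin (suc n) f (fsuc i) = ≤-trans (term≤sumFin n (f ∘ fsuc) i) (m≤n+m _ _)

sumFin-delta : ∀ n (x : Fin n) (g : Fin n → ℕ) →
               sumFin n (λ a → if does (a ≟ x) then g a else 0) ≡ g x
sumFin-delta (suc n) fzero    g = trans (cong (g fzero +_) (sumFin-zero n)) (+-identityʳ _)
sumFin-delta (suc n) (fsuc x) g = sumFin-delta n x (g ∘ fsuc)

sumFin-count-< : ∀ n k c → k ≤ n → sumFin n (λ i → if toℕ i <ᵇ k then c else 0) ≡ k * c
sumFin-count-< n       zero    c _          = sumFin-zero n
sumFin-count-< (suc n) (suc k) c (s≤s k≤n) = cong (c +_) (sumFin-count-< n k c k≤n)

<ᵇ≡true⇒< : ∀ m n → (m <ᵇ n) ≡ true → m < n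
<ᵇ≡true⇒< m n m<ᵇn = <ᵇ⇒< m n (subst T (sym m<ᵇn) tt)

<ᵇ≡false⇒≮ : ∀ m n → (m <ᵇ n) ≡ false → ¬ m < n
<ᵇ≡false⇒≮ m n m<ᵇn m<n = subst T m<ᵇn (<⇒<ᵇ m<n)

<⇒<ᵇ≡true : ∀ {m n} → m < n → (m <ᵇ n) ≡ true
<⇒<ᵇ≡true {m} {n} m<n with m <ᵇ n in m<ᵇn
... | true  = refl
... | false = ⊥-elim (<ᵇ≡false⇒≮ m n m<ᵇn m<n)

if-then-else-0≤ : ∀ b m → (if b then m else 0) ≤ m
if-then-else-0≤ true  m = ≤-refl
if-then-else-0≤ false m = z≤n

ordered+reversed : ∀ {m} (a b : Fin m) k →
  (if toℕ a <ᵇ toℕ b then k else 0) + (if toℕ b <ᵇ toℕ a then k else 0) ≡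
  (if does (a ≟ b) then 0 else k)
ordered+reversed a b k with toℕ a <ᵇ toℕ b in a<b | toℕ b <ᵇ toℕ a in b<a | a ≟ b
... | true  | true  | _        = ⊥-elim (<-asym (<ᵇ≡true⇒< (toℕ a) (toℕ b) a<b) (<ᵇ≡true⇒< (toℕ b) (toℕ a) b<a))
... | true  | false | yes refl = ⊥-elim (<-irrefl refl (<ᵇ≡true⇒< (toℕ a) (toℕ a) a<b))
... | true  | false | no _     = +-identityʳ k
... | false | true  | yes refl = ⊥-elim (<-irrefl refl (<ᵇ≡true⇒< (toℕ a) (toℕ a) b<a))
... | false | true  | no _     = refl
... | false | false | yes _    = refl
... | false | false | no a≢b   = ⊥-elim (a≢b (toℕ-injective
  (≤-antisym (≮⇒≥ (<ᵇ≡false⇒≮ (toℕ b) (toℕ a) b<a)) (≮⇒≥ (<ᵇ≡false⇒≮ (toℕ a) (toℕ b) a<b)))))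

numEdges≤sumFin-deg : ∀ {n} (G : MultiGraph n) → numEdges G ≤ sumFin n (deg G)
numEdges≤sumFin-deg {n} G =
  sumFin-mono n λ u → sumFin-mono n λ v → if-then-else-0≤ (toℕ u <ᵇ toℕ v) (mult G u v)

crossDeg≤deg : ∀ {n} (G : MultiGraph n) S v → crossDeg G S v ≤ deg G v
crossDeg≤deg {n} G S v = sumFin-mono n λ u → if-then-else-0≤ (S u xor S v) (mult G v u)

crossDeg≤cutValue : ∀ {n} (G : MultiGraph n) S v → crossDeg G S v ≤ cutValue G S
crossDeg≤cutValue {n} G S v with S v in Sv
... | true  = ≤-trans (≤-reflexive (sumFin-cong n outgoing)) (term≤sumFin n _ v)
  where
  outgoing : ∀ u → (if S u xor true then mult G v u else 0) ≡
                   (if S v ∧ not (S u) then mult G v u else 0)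
  outgoing u rewrite Sv with S u
  ... | true  = refl
  ... | false = refl
... | false = ≤-trans (≤-reflexive (sumFin-cong n incoming))
                      (sumFin-mono n λ u → term≤sumFin n _ v)
  where
  incoming : ∀ u → (if S u xor false then mult G v u else 0) ≡
                   (if S u ∧ not (S v) then mult G u v else 0)
  incoming u rewrite Sv with S u
  ... | true  = symm G v u
  ... | false = refl

cutValue≤*size : ∀ {n} (G : MultiGraph n) (S : Cut n) →
  (∀ u v → S u ≡ true → S v ≡ false → mult G u v ≤ 1) →
  cutValue G S ≤ n * sumFin n (λ u → if S u then 1 else 0)
cutValue≤*size {n} G S simple = begin
  cutValue G S                                              ≤⟨ sumFin-mono n (λ u → sumFin-mono n (crossing u)) ⟩
  sumFin n (λ u → sumFin n (λ _ → if S u then 1 else 0))   ≡⟨ sumFin-cong n (λ u → sumFin-const n _) ⟩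
  sumFin n (λ u → n * (if S u then 1 else 0))               ≡⟨ sumFin-distribˡ-* n n _ ⟩
  n * sumFin n (λ u → if S u then 1 else 0)                 ∎
  where
  open ≤-Reasoning
  crossing : ∀ u v → (if S u ∧ not (S v) then mult G u v else 0) ≤ (if S u then 1 else 0)
  crossing u v with S u in Su | S v in Sv
  ... | true  | true  = z≤n
  ... | true  | false = simple u v Su Sv
  ... | false | _     = z≤n

minCuts-friendly : ∀ {n} (G : MultiGraph n) {s t} (S₀ : Cut n) → S₀ s ≡ true → S₀ t ≡ false →
  (∀ v → deg G v ≡ 0 ⊎ 10 * cutValue G S₀ ≤ 6 * deg G v) →
  ∀ S → IsMinCut G s t S → Friendly G S
minCuts-friendly G S₀ S₀s S₀t degree-bound S (_ , _ , minimal) v with degree-bound v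
... | inj₁ isolated =
  ≤-trans (*-monoʳ-≤ 10 (≤-trans (crossDeg≤deg G S v) (≤-reflexive isolated))) z≤n
... | inj₂ large =
  ≤-trans (*-monoʳ-≤ 10 (≤-trans (crossDeg≤cutValue G S v) (minimal S₀ S₀s S₀t))) large

if-swap : ∀ b c (k : ℕ) →
  (if b then (if c then k else 0) else 0) ≡ (if c then (if b then k else 0) else 0)
if-swap true  c     k = refl
if-swap false true  k = refl
if-swap false false k = refl

sumFin-comm² : ∀ m n (f : Fin m → Fin m → Fin n → Fin n → ℕ) →
  sumFin m (λ a → sumFin m (λ b → sumFin n (λ u → sumFin n (λ v → f a b u v)))) ≡
  sumFin n (λ u → sumFin n (λ v → sumFin m (λ a → sumFin m (λ b → f a b u v))))
sumFin-comm² m n f = begin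
  sumFin m (λ a → sumFin m (λ b → sumFin n (λ u → sumFin n (λ v → f a b u v))))
    ≡⟨ sumFin-cong m (λ a → sumFin-comm m n _) ⟩
  sumFin m (λ a → sumFin n (λ u → sumFin m (λ b → sumFin n (λ v → f a b u v))))
    ≡⟨ sumFin-comm m n _ ⟩
  sumFin n (λ u → sumFin m (λ a → sumFin m (λ b → sumFin n (λ v → f a b u v))))
    ≡⟨ sumFin-cong n (λ u → sumFin-cong m (λ a → sumFin-comm m n _)) ⟩
  sumFin n (λ u → sumFin m (λ a → sumFin n (λ v → sumFin m (λ b → f a b u v))))
    ≡⟨ sumFin-cong n (λ u → sumFin-comm m n _) ⟩
  sumFin n (λ u → sumFin n (λ v → sumFin m (λ a → sumFin m (λ b → f a b u v))))
    ∎
  where open ≡-Reasoning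

sumFin-delta² : ∀ m (x y : Fin m) (g : Fin m → Fin m → ℕ) →
  sumFin m (λ a → sumFin m (λ b → if does (x ≟ a) ∧ does (y ≟ b) then g a b else 0)) ≡ g x y
sumFin-delta² m x y g = begin
  sumFin m (λ a → sumFin m (λ b → if does (x ≟ a) ∧ does (y ≟ b) then g a b else 0))
    ≡⟨ sumFin-cong m (λ a → sumFin-cong m (λ b → split a b)) ⟩
  sumFin m (λ a → sumFin m (λ b → if does (a ≟ x) then (if does (b ≟ y) then g a b else 0) else 0))
    ≡⟨ sumFin-cong m (λ a → sumFin-if m (does (a ≟ x)) _) ⟩
  sumFin m (λ a → if does (a ≟ x) then sumFin m (λ b → if does (b ≟ y) then g a b else 0) else 0)
    ≡⟨ sumFin-delta m x _ ⟩
  sumFin m (λ b → if does (b ≟ y) then g x b else 0)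
    ≡⟨ sumFin-delta m y _ ⟩
  g x y
    ∎
  where
  open ≡-Reasoning
  split : ∀ a b → (if does (x ≟ a) ∧ does (y ≟ b) then g a b else 0) ≡
                  (if does (a ≟ x) then (if does (b ≟ y) then g a b else 0) else 0)
  split a b rewrite does-⇔ (mk⇔ sym sym) (x ≟ a) (a ≟ x) | does-⇔ (mk⇔ sym sym) (y ≟ b) (b ≟ y)
    with does (a ≟ x)
  ... | true  = refl
  ... | false = refl

module _ {n} {G : MultiGraph n} (H : Sparsifier G) where

  fibreKeep : Fin (m H) → Fin (m H) → ℕ
  fibreKeep a b = sumFin n λ u → sumFin n λ v →
    if does (π H u ≟ a) ∧ does (π H v ≟ b) then keep H u v else 0

  sparsMult-ordered : ∀ a b →
    (if toℕ a <ᵇ toℕ b then sparsMult H a b else 0) ≡ (if toℕ a <ᵇ toℕ b then fibreKeep a b else 0)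
  sparsMult-ordered a b with toℕ a <ᵇ toℕ b in a<b
  ... | false = refl
  ... | true  rewrite dec-false (a ≟ b) λ { refl → <-irrefl refl (<ᵇ≡true⇒< (toℕ a) (toℕ a) a<b) } = refl

  sparsEdges≡orderedKept : sparsEdges H ≡
    sumFin n (λ u → sumFin n (λ v → if toℕ (π H u) <ᵇ toℕ (π H v) then keep H u v else 0))
  sparsEdges≡orderedKept = begin
    sparsEdges H
      ≡⟨ sumFin-cong (m H) (λ a → sumFin-cong (m H) (sparsMult-ordered a)) ⟩
    sumFin (m H) (λ a → sumFin (m H) (λ b → if toℕ a <ᵇ toℕ b then fibreKeep a b else 0))
      ≡⟨ sumFin-cong (m H) (λ a → sumFin-cong (m H) (λ b → pushIn a b)) ⟩
    sumFin (m H) (λ a → sumFin (m H) (λ b → sumFin n (λ u → sumFin n (λ v → F a b u v))))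
      ≡⟨ sumFin-comm² (m H) n F ⟩
    sumFin n (λ u → sumFin n (λ v → sumFin (m H) (λ a → sumFin (m H) (λ b → F a b u v))))
      ≡⟨ sumFin-cong n (λ u → sumFin-cong n (λ v →
           sumFin-delta² (m H) (π H u) (π H v) (λ a b → if toℕ a <ᵇ toℕ b then keep H u v else 0))) ⟩
    sumFin n (λ u → sumFin n (λ v → if toℕ (π H u) <ᵇ toℕ (π H v) then keep H u v else 0))
      ∎
    where
    open ≡-Reasoning
    F : Fin (m H) → Fin (m H) → Fin n → Fin n → ℕ
    F a b u v = if does (π H u ≟ a) ∧ does (π H v ≟ b) then (if toℕ a <ᵇ toℕ b then keep H u v else 0) else 0
    pushIn : ∀ a b → (if toℕ a <ᵇ toℕ b then fibreKeep a b else 0) ≡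
                     sumFin n (λ u → sumFin n (λ v → F a b u v))
    pushIn a b = begin
      (if toℕ a <ᵇ toℕ b then fibreKeep a b else 0)
        ≡⟨ sym (sumFin-if n (toℕ a <ᵇ toℕ b) _) ⟩
      sumFin n (λ u → if toℕ a <ᵇ toℕ b then sumFin n _ else 0)
        ≡⟨ sumFin-cong n (λ u → sym (sumFin-if n (toℕ a <ᵇ toℕ b) _)) ⟩
      sumFin n (λ u → sumFin n (λ v → if toℕ a <ᵇ toℕ b then
        (if does (π H u ≟ a) ∧ does (π H v ≟ b) then keep H u v else 0) else 0))
        ≡⟨ sumFin-cong n (λ u → sumFin-cong n (λ v → if-swap (toℕ a <ᵇ toℕ b) (does (π H u ≟ a) ∧ does (π H v ≟ b)) (keep H u v))) ⟩
      sumFin n (λ u → sumFin n (λ v → F a b u v))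
        ∎

  2*sparsEdges≡separatedKept : 2 * sparsEdges H ≡
    sumFin n (λ u → sumFin n (λ v → if does (π H u ≟ π H v) then 0 else keep H u v))
  2*sparsEdges≡separatedKept = begin
    2 * sparsEdges H
      ≡⟨ cong (sparsEdges H +_) (+-identityʳ _) ⟩
    sparsEdges H + sparsEdges H
      ≡⟨ cong₂ _+_ sparsEdges≡orderedKept (trans sparsEdges≡orderedKept reversed) ⟩
    sumFin n (λ u → sumFin n (λ v → ordered u v)) + sumFin n (λ u → sumFin n (λ v → ordered v u))
      ≡⟨ sym (trans (sumFin-cong n (λ u → sumFin-distrib-+ n _ _)) (sumFin-distrib-+ n _ _)) ⟩
    sumFin n (λ u → sumFin n (λ v → ordered u v + ordered v u))
      ≡⟨ sumFin-cong n (λ u → sumFin-cong n (λ v → trans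
           (cong (ordered u v +_) (cong (λ k → if toℕ (π H v) <ᵇ toℕ (π H u) then k else 0) (keepSymm H v u)))
           (ordered+reversed (π H u) (π H v) (keep H u v)))) ⟩
    sumFin n (λ u → sumFin n (λ v → if does (π H u ≟ π H v) then 0 else keep H u v))
      ∎
    where
    open ≡-Reasoning
    ordered : Fin n → Fin n → ℕ
    ordered u v = if toℕ (π H u) <ᵇ toℕ (π H v) then keep H u v else 0
    reversed : sumFin n (λ u → sumFin n (λ v → ordered u v)) ≡
               sumFin n (λ u → sumFin n (λ v → ordered v u))
    reversed = sumFin-comm n n _

  pairs≤2*sparsEdges : (R : Fin n → Fin n → Bool) →
    (∀ u v → R u v ≡ true → 1 ≤ keep H u v × π H u ≢ π H v) →
    sumFin n (λ u → sumFin n (λ v → if R u v then 1 else 0)) ≤ 2 * sparsEdges H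
  pairs≤2*sparsEdges R preserved =
    ≤-trans (sumFin-mono n λ u → sumFin-mono n (pair≤ u)) (≤-reflexive (sym 2*sparsEdges≡separatedKept))
    where
    pair≤ : ∀ u v → (if R u v then 1 else 0) ≤ (if does (π H u ≟ π H v) then 0 else keep H u v)
    pair≤ u v with R u v in Ruv
    ... | false = z≤n
    ... | true  with preserved u v Ruv
    ...   | kept , separated rewrite dec-false (π H u ≟ π H v) separated = kept

opposite-sym : ∀ {n} {u v : Fin n} → u ≡ opposite v → v ≡ opposite u
opposite-sym {v = v} u≡v̄ = trans (sym (opposite-involutive v)) (cong opposite (sym u≡v̄))

does-≟-sym : ∀ {n} (u v : Fin n) → does (u ≟ v) ≡ does (v ≟ u)
does-≟-sym u v = does-⇔ (mk⇔ sym sym) (u ≟ v) (v ≟ u)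

does-≟-opposite-sym : ∀ {n} (u v : Fin n) → does (u ≟ opposite v) ≡ does (v ≟ opposite u)
does-≟-opposite-sym u v = does-⇔ (mk⇔ opposite-sym opposite-sym) (u ≟ opposite v) (v ≟ opposite u)

module MirrorGraph (n : ℕ) where

  heavy : ℕ
  heavy = 4 * n

  weight : Fin n → Fin n → ℕ
  weight u v =
    if does (u ≟ v) then 0
    else if does (u ≟ opposite v) then heavy
    else if does (u ≟ opposite u) ∨ does (v ≟ opposite v) then 0
    else 1

  weight-sym : ∀ u v → weight u v ≡ weight v u
  weight-sym u v
    rewrite does-≟-sym u v | does-≟-opposite-sym u v
          | ∨-comm (does (u ≟ opposite u)) (does (v ≟ opposite v)) = refl

  weight-loopless : ∀ u → weight u u ≡ 0
  weight-loopless u rewrite dec-true (u ≟ u) refl = refl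

  mirrorGraph : MultiGraph n
  mirrorGraph = record { mult = weight ; symm = weight-sym ; loopless = weight-loopless }

  weight≤ : ∀ u v → weight u v ≤ (if does (v ≟ opposite u) then heavy else 0) + 1
  weight≤ u v rewrite does-≟-opposite-sym v u with u ≟ v | u ≟ opposite v
  ... | yes _ | _     = z≤n
  ... | no _  | yes _ = m≤m+n heavy 1
  ... | no _  | no _  with does (u ≟ opposite u) ∨ does (v ≟ opposite v)
  ...   | true  = z≤n
  ...   | false = ≤-refl

  weight≤1 : ∀ u v → u ≢ opposite v → weight u v ≤ 1
  weight≤1 u v u≢v̄ =
    subst (λ b → weight u v ≤ (if b then heavy else 0) + 1)
          (dec-false (v ≟ opposite u) (u≢v̄ ∘ opposite-sym)) (weight≤ u v)

  weight-unit : ∀ u v → u ≢ v → u ≢ opposite v → u ≢ opposite u → v ≢ opposite v → weight u v ≡ 1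
  weight-unit u v u≢v u≢v̄ u≢ū v≢v̄
    rewrite dec-false (u ≟ v) u≢v | dec-false (u ≟ opposite v) u≢v̄
          | dec-false (u ≟ opposite u) u≢ū | dec-false (v ≟ opposite v) v≢v̄ = refl

  weight-opposite : ∀ v → v ≢ opposite v → weight v (opposite v) ≡ heavy
  weight-opposite v v≢v̄
    rewrite dec-false (v ≟ opposite v) v≢v̄
          | dec-true (v ≟ opposite (opposite v)) (sym (opposite-involutive v)) = refl

  weight-fixed : ∀ v → v ≡ opposite v → ∀ u → weight v u ≡ 0
  weight-fixed v v≡v̄ u with v ≟ u
  ... | yes _   = refl
  ... | no v≢u rewrite dec-false (v ≟ opposite u) (λ v≡ū → v≢u (sym (trans (opposite-sym v≡ū) (sym v≡v̄))))
                     | dec-true (v ≟ opposite v) v≡v̄ = refl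

  deg≤ : ∀ u → deg mirrorGraph u ≤ heavy + n
  deg≤ u = begin
    sumFin n (weight u)
      ≤⟨ sumFin-mono n (weight≤ u) ⟩
    sumFin n (λ v → (if does (v ≟ opposite u) then heavy else 0) + 1)
      ≡⟨ sumFin-distrib-+ n _ _ ⟩
    sumFin n (λ v → if does (v ≟ opposite u) then heavy else 0) + sumFin n (λ _ → 1)
      ≡⟨ cong₂ _+_ (sumFin-delta n (opposite u) (λ _ → heavy)) (trans (sumFin-const n 1) (*-identityʳ n)) ⟩
    heavy + n
      ∎
    where open ≤-Reasoning

  numEdges-mirrorGraph : numEdges mirrorGraph ≤ 5 * (n * n)
  numEdges-mirrorGraph = begin
    numEdges mirrorGraph                 ≤⟨ numEdges≤sumFin-deg mirrorGraph ⟩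
    sumFin n (deg mirrorGraph)           ≤⟨ sumFin-mono n deg≤ ⟩
    sumFin n (λ _ → heavy + n)           ≡⟨ sumFin-const n _ ⟩
    n * (4 * n + n)                      ≡⟨ collect n ⟩
    5 * (n * n)                          ∎
    where
    open ≤-Reasoning
    collect : ∀ n → n * (4 * n + n) ≡ 5 * (n * n)
    collect = solve-∀

  deg-isolated-or-heavy : ∀ v → deg mirrorGraph v ≡ 0 ⊎ heavy ≤ deg mirrorGraph v
  deg-isolated-or-heavy v = by-cases (v ≟ opposite v)
    where
    by-cases : Dec (v ≡ opposite v) → deg mirrorGraph v ≡ 0 ⊎ heavy ≤ deg mirrorGraph v
    by-cases (yes v≡v̄) = inj₁ (trans (sumFin-cong n (weight-fixed v v≡v̄)) (sumFin-zero n))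
    by-cases (no v≢v̄)  = inj₂ (subst (_≤ deg mirrorGraph v) (weight-opposite v v≢v̄)
                                     (term≤sumFin n (weight v) (opposite v)))

  mirrorPair : Fin n → Cut n
  mirrorPair s w = does (w ≟ s) ∨ does (w ≟ opposite s)

  mirrorPair-crossing : ∀ s u v → mirrorPair s u ≡ true → mirrorPair s v ≡ false → u ≢ opposite v
  mirrorPair-crossing s u v Su Sv with u ≟ s | u ≟ opposite s | v ≟ s | v ≟ opposite s
  mirrorPair-crossing s u v () Sv | no _ | no _ | _ | _
  mirrorPair-crossing s u v Su () | _ | _ | yes _ | _
  mirrorPair-crossing s u v Su () | _ | _ | no _ | yes _
  mirrorPair-crossing s u v Su Sv | yes u≡s | _ | no _ | no v≢s̄ =
    λ u≡v̄ → v≢s̄ (trans (opposite-sym u≡v̄) (cong opposite u≡s))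
  mirrorPair-crossing s u v Su Sv | no _ | yes u≡s̄ | no v≢s | no _ =
    λ u≡v̄ → v≢s (trans (opposite-sym u≡v̄) (trans (cong opposite u≡s̄) (opposite-involutive s)))

  cutValue-mirrorPair : ∀ s → cutValue mirrorGraph (mirrorPair s) ≤ n * 2
  cutValue-mirrorPair s = begin
    cutValue mirrorGraph (mirrorPair s)
      ≤⟨ cutValue≤*size mirrorGraph (mirrorPair s)
           (λ u v Su Sv → weight≤1 u v (mirrorPair-crossing s u v Su Sv)) ⟩
    n * sumFin n (λ u → if mirrorPair s u then 1 else 0)
      ≤⟨ *-monoʳ-≤ n (sumFin-mono n indicator-∨) ⟩
    n * sumFin n (λ u → (if does (u ≟ s) then 1 else 0) + (if does (u ≟ opposite s) then 1 else 0))
      ≡⟨ cong (n *_) (trans (sumFin-distrib-+ n _ _)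
                            (cong₂ _+_ (sumFin-delta n s _) (sumFin-delta n (opposite s) _))) ⟩
    n * 2
      ∎
    where
    open ≤-Reasoning
    indicator-∨ : ∀ u → (if mirrorPair s u then 1 else 0) ≤
                        (if does (u ≟ s) then 1 else 0) + (if does (u ≟ opposite s) then 1 else 0)
    indicator-∨ u with does (u ≟ s)
    ... | true  = m≤m+n 1 _
    ... | false = ≤-refl

  minCuts-friendly-mirrorGraph : ∀ s t → s ≢ t → s ≢ opposite t →
    ∀ S → IsMinCut mirrorGraph s t S → Friendly mirrorGraph S
  minCuts-friendly-mirrorGraph s t s≢t s≢t̄ =
    minCuts-friendly mirrorGraph (mirrorPair s) s∈pair t∉pair degree-bound
    where
    s∈pair : mirrorPair s s ≡ true
    s∈pair rewrite dec-true (s ≟ s) refl = refl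
    t∉pair : mirrorPair s t ≡ false
    t∉pair rewrite dec-false (t ≟ s) (s≢t ∘ sym) | dec-false (t ≟ opposite s) (s≢t̄ ∘ opposite-sym) = refl
    20n≤24n : ∀ n → 10 * (n * 2) ≤ 6 * (4 * n)
    20n≤24n n = subst₂ _≤_ (lhs n) (rhs n) (*-monoˡ-≤ n (m≤m+n 20 4))
      where
      lhs : ∀ n → 20 * n ≡ 10 * (n * 2)
      lhs = solve-∀
      rhs : ∀ n → 24 * n ≡ 6 * (4 * n)
      rhs = solve-∀
    degree-bound : ∀ v → deg mirrorGraph v ≡ 0 ⊎ 10 * cutValue mirrorGraph (mirrorPair s) ≤ 6 * deg mirrorGraph v
    degree-bound v with deg-isolated-or-heavy v
    ... | inj₁ isolated = inj₁ isolated
    ... | inj₂ heavy≤deg = inj₂ (begin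
      10 * cutValue mirrorGraph (mirrorPair s) ≤⟨ *-monoʳ-≤ 10 (cutValue-mirrorPair s) ⟩
      10 * (n * 2)                             ≤⟨ 20n≤24n n ⟩
      6 * heavy                                ≤⟨ *-monoʳ-≤ 6 heavy≤deg ⟩
      6 * deg mirrorGraph v                    ∎)
      where open ≤-Reasoning

  unitEdge-preserved : ∀ (H : Sparsifier mirrorGraph) → IsFriendlyMinCutSparsifier mirrorGraph H →
    ∀ s t → s ≢ t → s ≢ opposite t → s ≢ opposite s → t ≢ opposite t →
    1 ≤ keep H s t × π H s ≢ π H t
  unitEdge-preserved H sparsifier s t s≢t s≢t̄ s≢s̄ t≢t̄
    with sparsifier s t s≢t (minCuts-friendly-mirrorGraph s t s≢t s≢t̄)
  ... | S , (Ss , St , _) , kept , separated =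
    ≤-reflexive (sym (trans (kept s t Ss St) (weight-unit s t s≢t s≢t̄ s≢s̄ t≢t̄))) , separated s t Ss St

  module Blocks (q : ℕ) (4q≤n : q * 4 ≤ n) where

    2q+2q≤n : (q + q) + (q + q) ≤ n
    2q+2q≤n = ≤-trans (≤-reflexive (regroup q)) 4q≤n
      where
      regroup : ∀ q → (q + q) + (q + q) ≡ q * 4
      regroup = solve-∀

    2q≤n : q + q ≤ n
    2q≤n = ≤-trans (m≤m+n (q + q) (q + q)) 2q+2q≤n

    q≤n : q ≤ n
    q≤n = ≤-trans (m≤m+n q q) 2q≤n

    low≢opposite-low : ∀ a b → toℕ a < q + q → toℕ b < q + q → a ≢ opposite b
    low≢opposite-low a b a<2q b<2q a≡b̄ = <-irrefl sum≡n sum<n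
      where
      sum≡n : toℕ a + suc (toℕ b) ≡ n
      sum≡n = trans (cong (λ x → toℕ x + suc (toℕ b)) a≡b̄)
                    (trans (cong (_+ suc (toℕ b)) (opposite-prop b)) (m∸n+n≡m (toℕ<n b)))
      sum<n : toℕ a + suc (toℕ b) < n
      sum<n = ≤-trans (+-mono-≤ a<2q b<2q) 2q+2q≤n

    inSecondBlock : Fin n → Bool
    inSecondBlock v = not (toℕ v <ᵇ q) ∧ (toℕ v <ᵇ q + q)

    blockPair : Fin n → Fin n → Bool
    blockPair u v = (toℕ u <ᵇ q) ∧ inSecondBlock v

    count-inSecondBlock : sumFin n (λ v → if inSecondBlock v then 1 else 0) ≡ q
    count-inSecondBlock = +-cancelˡ-≡ q _ _ (begin
      q + sumFin n (λ v → if inSecondBlock v then 1 else 0)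
        ≡⟨ cong (_+ sumFin n (λ v → if inSecondBlock v then 1 else 0))
                (sym (trans (sumFin-count-< n q 1 q≤n) (*-identityʳ q))) ⟩
      sumFin n (λ v → if toℕ v <ᵇ q then 1 else 0) + sumFin n (λ v → if inSecondBlock v then 1 else 0)
        ≡⟨ sym (sumFin-distrib-+ n _ _) ⟩
      sumFin n (λ v → (if toℕ v <ᵇ q then 1 else 0) + (if inSecondBlock v then 1 else 0))
        ≡⟨ sumFin-cong n firstBlock-or-secondBlock ⟩
      sumFin n (λ v → if toℕ v <ᵇ q + q then 1 else 0)
        ≡⟨ trans (sumFin-count-< n (q + q) 1 2q≤n) (*-identityʳ (q + q)) ⟩
      q + q
        ∎)
      where
      open ≡-Reasoning
      firstBlock-or-secondBlock : ∀ v →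
        (if toℕ v <ᵇ q then 1 else 0) + (if inSecondBlock v then 1 else 0) ≡
        (if toℕ v <ᵇ q + q then 1 else 0)
      firstBlock-or-secondBlock v with toℕ v <ᵇ q in v<ᵇq
      ... | false = refl
      ... | true  rewrite <⇒<ᵇ≡true (≤-trans (<ᵇ≡true⇒< (toℕ v) q v<ᵇq) (m≤m+n q q)) = refl

    count-blockPair : sumFin n (λ u → sumFin n (λ v → if blockPair u v then 1 else 0)) ≡ q * q
    count-blockPair = trans (sumFin-cong n row) (sumFin-count-< n q q q≤n)
      where
      row : ∀ u → sumFin n (λ v → if blockPair u v then 1 else 0) ≡ (if toℕ u <ᵇ q then q else 0)
      row u with toℕ u <ᵇ q
      ... | true  = count-inSecondBlock
      ... | false = sumFin-zero n

    module _ (H : Sparsifier mirrorGraph) (sparsifier : IsFriendlyMinCutSparsifier mirrorGraph H) where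

      blockPair-preserved : ∀ u v → blockPair u v ≡ true → 1 ≤ keep H u v × π H u ≢ π H v
      blockPair-preserved u v uv with toℕ u <ᵇ q in u<ᵇq | toℕ v <ᵇ q in v<ᵇq | toℕ v <ᵇ q + q in v<ᵇ2q
      blockPair-preserved u v () | false | _     | _
      blockPair-preserved u v () | true  | true  | _
      blockPair-preserved u v () | true  | false | false
      blockPair-preserved u v uv | true  | false | true  =
        unitEdge-preserved H sparsifier u v u≢v
          (low≢opposite-low u v u<2q v<2q) (low≢opposite-low u u u<2q u<2q) (low≢opposite-low v v v<2q v<2q)
        where
        u<q : toℕ u < q
        u<q = <ᵇ≡true⇒< (toℕ u) q u<ᵇq
        u<2q : toℕ u < q + q
        u<2q = ≤-trans u<q (m≤m+n q q)
        v<2q : toℕ v < q + q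
        v<2q = <ᵇ≡true⇒< (toℕ v) (q + q) v<ᵇ2q
        u≢v : u ≢ v
        u≢v refl = <ᵇ≡false⇒≮ (toℕ u) q v<ᵇq u<q

      sparsEdges-lower-bound : q * q ≤ 2 * sparsEdges H
      sparsEdges-lower-bound =
        subst (_≤ 2 * sparsEdges H) count-blockPair (pairs≤2*sparsEdges H blockPair blockPair-preserved)

n≤5*[n/4] : ∀ n → 16 ≤ n → n ≤ 5 * (n / 4)
n≤5*[n/4] n 16≤n = begin
  n                      ≡⟨ m≡m%n+[m/n]*n n 4 ⟩
  n % 4 + n / 4 * 4      ≤⟨ +-monoˡ-≤ (n / 4 * 4) (≤-trans (<⇒≤ (m%n<n n 4)) (/-monoˡ-≤ 4 16≤n)) ⟩
  n / 4 + n / 4 * 4      ≡⟨ collect (n / 4) ⟩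
  5 * (n / 4)            ∎
  where
  open ≤-Reasoning
  collect : ∀ q → q + q * 4 ≡ 5 * q
  collect = solve-∀

mainTheorem8 : ∃ λ (C : ℕ) → ∃ λ (c : ℕ) → ∃ λ (N₀ : ℕ) →
  ∀ (n : ℕ) → N₀ ≤ n →
  ∃ λ (G : MultiGraph n) →
    numEdges G ≤ C * (n * n) ×
    (∀ (H : Sparsifier G) → IsFriendlyMinCutSparsifier G H →
      n * n ≤ c * sparsEdges H)
mainTheorem8 = 5 , 50 , 16 , λ n 16≤n →
  let open MirrorGraph n
      open Blocks (n / 4) (m/n*n≤m n 4)
  in mirrorGraph , numEdges-mirrorGraph , λ H sparsifier → begin
    n * n                          ≤⟨ *-mono-≤ (n≤5*[n/4] n 16≤n) (n≤5*[n/4] n 16≤n) ⟩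
    5 * (n / 4) * (5 * (n / 4))    ≡⟨ square-scale (n / 4) ⟩
    25 * (n / 4 * (n / 4))         ≤⟨ *-monoʳ-≤ 25 (sparsEdges-lower-bound H sparsifier) ⟩
    25 * (2 * sparsEdges H)        ≡⟨ sym (*-assoc 25 2 (sparsEdges H)) ⟩
    50 * sparsEdges H              ∎
  where
  open ≤-Reasoning
  square-scale : ∀ q → 5 * q * (5 * q) ≡ 25 * (q * q)
  square-scale = solve-∀
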